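{- Let $k\ge 1$ be an integer, let $G$ be a graph containing no copy of $F_k$, let $u\in V(G)$, and let $X\subseteq N(u)$ be a set such that $$\sum_{i=1}^{\ell}\left\lfloor\frac{|C_i|}{2}\right\rfloor+|X|\le k-1,$$ where $C_1,\dots,C_\ell$ are the connected components of $G_u-X$. Then: (i) $\mathcal{H}(u)\subseteq X$; moreover $|\mathcal{H}(u)|\le k-1$, and if $|\mathcal{H}(u)|=k-1$ then $\mathcal{M}(u)=\emptyset$. (ii) $|\mathcal{H}(u)|+\frac{1}{2}|\mathcal{M}(u)|\le k-\frac{1}{2}$.
   Context: $F_k$ is the friendship graph: $k$ triangles sharing exactly one common vertex. For a vertex $u$, $N(u)$ is its neighborhood and $G_u=G[N(u)]$. For an edge $uv$, $N(uv)=N(u)\cap N(v)$ (so $|N(uv)|$ is the number of triangles containing $uv$). An edge $uv$ is heavy if $|N(uv)|\ge 2k-1$, medium if $k\le |N(uv)|\le 2k-2$, and light if $1\le |N(uv)|\le k-1$. Let $\mathcal{H}(u)=\{v\in N(u): uv \text{ heavy}\}$ and $\mathcal{M}(u)=\{v\in N(u): uv\text{ medium}\}$. -}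

module Defs where

open import Data.Nat using (ℕ; zero; suc; _+_; _*_; _∸_; _≤_; _≤ᵇ_; ⌊_/2⌋)
open import Data.Bool using (Bool; true; false; _∧_; not)
open import Data.Fin using (Fin)
import Data.Fin as Fin
open import Data.List using (List; length; filterᵇ; map; allFin)
open import Data.Nat.ListAction using (sum)
open import Data.Maybe using (Maybe; just; nothing)
open import Data.Product using (_×_; _,_; Σ; ∃)
open import Relation.Binary.PropositionalEquality using (_≡_)
open import Relation.Nullary using (¬_; does)
open import Function.Definitions using (Injective)

record Graph (n : ℕ) : Set where
  field
    adj    : Fin n → Fin n → Bool
    sym    : ∀ u v → adj u v ≡ adj v u
    irrefl : ∀ v → adj v v ≡ false
open Graph public

count : {n : ℕ} → (Fin n → Bool) → ℕ
count {n} p = length (filterᵇ p (allFin n))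

N : {n : ℕ} → Graph n → Fin n → Fin n → Bool
N G u v = adj G u v

codeg : {n : ℕ} → Graph n → Fin n → Fin n → ℕ
codeg G u v = count (λ w → adj G u w ∧ adj G v w)

heavy : {n : ℕ} → ℕ → Graph n → Fin n → Fin n → Bool
heavy k G u v = adj G u v ∧ ((2 * k ∸ 1) ≤ᵇ codeg G u v)

medium : {n : ℕ} → ℕ → Graph n → Fin n → Fin n → Bool
medium k G u v = adj G u v ∧ ((k ≤ᵇ codeg G u v) ∧ (codeg G u v ≤ᵇ (2 * k ∸ 2)))

𝓗 : {n : ℕ} → ℕ → Graph n → Fin n → Fin n → Bool
𝓗 k G u v = heavy k G u v

𝓜 : {n : ℕ} → ℕ → Graph n → Fin n → Fin n → Bool
𝓜 k G u v = medium k G u v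

-- The vertex map of a copy of F_k: center c, and the i-th triangle is c, a i, b i.
-- Vertices of F_k are indexed by Maybe (Fin k × Bool): nothing = center.
fkMap : {n k : ℕ} → Fin n → (Fin k → Fin n) → (Fin k → Fin n) → Maybe (Fin k × Bool) → Fin n
fkMap c a b nothing = c
fkMap c a b (just (i , true)) = a i
fkMap c a b (just (i , false)) = b i

record FkCopy {n : ℕ} (k : ℕ) (G : Graph n) : Set where
  field
    c   : Fin n
    a b : Fin k → Fin n
    inj : Injective _≡_ _≡_ (fkMap c a b)
    ca  : ∀ i → adj G c (a i) ≡ true
    cb  : ∀ i → adj G c (b i) ≡ true
    ab  : ∀ i → adj G (a i) (b i) ≡ true

FkFree : {n : ℕ} → ℕ → Graph n → Set
FkFree k G = ¬ FkCopy k G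

data Conn {n : ℕ} (G : Graph n) (S : Fin n → Bool) : Fin n → Fin n → Set where
  here : ∀ {v} → S v ≡ true → Conn G S v v
  step : ∀ {v w x} → Conn G S v w → adj G w x ≡ true → S x ≡ true → Conn G S v x

GuMinus : {n : ℕ} → Graph n → Fin n → (Fin n → Bool) → Fin n → Bool
GuMinus G u X v = adj G u v ∧ not (X v)

-- c labels the connected components of G[S] (labels in Fin m; some may be unused)
IsComponentLabelling : {n m : ℕ} → Graph n → (Fin n → Bool) → (Fin n → Fin m) → Set
IsComponentLabelling G S c =
  ∀ v w → S v ≡ true → S w ≡ true →
    ((c v ≡ c w → Conn G S v w) × (Conn G S v w → c v ≡ c w))

sumHalfComponents : {n m : ℕ} → (Fin n → Bool) → (Fin n → Fin m) → ℕ
sumHalfComponents {n} {m} S c =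
  sum (map (λ j → ⌊ count (λ v → S v ∧ does (c v Fin.≟ j)) /2⌋) (allFin m))

{-# OPTIONS --safe #-}
-- For v ∈ N(u) ∖ X, a common neighbour of u and v lies either in X or, being adjacent to v
-- inside G_u − X, in the component C of v; and v itself is in C but is no common neighbour.
-- Hence |N(uv)| ≤ |X| + |C| − 1 ≤ |X| + 2⌊|C|/2⌋ ≤ 2(k − 1), so no heavy edge leaves X.
-- A medium edge uv with v ∉ X needs |X| + 2⌊|C|/2⌋ ≥ k, which the budget allows for at most
-- one component, so |𝓜(u) ∖ X| ≤ |C| ≤ 2 Σ ⌊|C_i|/2⌋ + 1; together with the disjointness of
-- 𝓗(u) and 𝓜(u) ∩ X inside X this gives (ii).
module Submission where

open import Data.Bool using (Bool; true; false; _∧_; not; T)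
open import Data.Empty using (⊥)
open import Data.Fin using (Fin)
import Data.Fin as Fin
open import Data.List using (List; []; _∷_; length; filterᵇ; allFin; tabulate)
open import Data.List.Membership.Propositional using (_∈_)
open import Data.List.Membership.Propositional.Properties using (∈-allFin)
open import Data.List.Properties using (map-tabulate)
import Data.List.Relation.Unary.Any as Any
open import Data.Nat using (ℕ; zero; suc; _+_; _*_; _∸_; _≤_; _<_; _≤ᵇ_; ⌊_/2⌋; z≤n; s≤s; s≤s⁻¹)
open import Data.Nat.ListAction using (sum)
open import Data.Nat.Properties
open import Data.Nat.Tactic.RingSolver using (solve-∀)
open import Data.Product using (_×_; _,_; proj₁; proj₂)
open import Data.Sum using (_⊎_; inj₁; inj₂)
open import Data.Unit using (tt)
open import Function using (_∘_)
open import Relation.Binary.PropositionalEquality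
open import Relation.Nullary using (does; yes; no)
open import Relation.Nullary.Decidable using (dec-true)
open import Defs hiding (sym)
open import Algebra.Properties.CommutativeSemigroup +-commutativeSemigroup using (interchange)

∧-≡true⁻ : ∀ {a b} → a ∧ b ≡ true → a ≡ true × b ≡ true
∧-≡true⁻ {true} b≡true = refl , b≡true

not-≡true⁻ : ∀ {a} → not a ≡ true → a ≡ false
not-≡true⁻ {false} _ = refl

≤ᵇ-≡true⁻ : ∀ {a b} → (a ≤ᵇ b) ≡ true → a ≤ b
≤ᵇ-≡true⁻ {a} {b} a≤ᵇb = ≤ᵇ⇒≤ a b (subst T (sym a≤ᵇb) tt)

𝟙 : Bool → ℕ
𝟙 true  = 1
𝟙 false = 0

𝟙-mono : ∀ {a b} → (a ≡ true → b ≡ true) → 𝟙 a ≤ 𝟙 b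
𝟙-mono {false} a⇒b = z≤n
𝟙-mono {true}  a⇒b rewrite a⇒b refl = ≤-refl

𝟙-≤-+ : ∀ {a b c} → (a ≡ true → b ≡ true ⊎ c ≡ true) → 𝟙 a ≤ 𝟙 b + 𝟙 c
𝟙-≤-+ {false} a⇒b∨c = z≤n
𝟙-≤-+ {true} a⇒b∨c with a⇒b∨c refl
... | inj₁ refl = s≤s z≤n
... | inj₂ refl = m≤n+m 1 _

𝟙-+-≤ : ∀ {a b c} → (a ≡ true → c ≡ true) → (b ≡ true → c ≡ true) →
        (a ≡ true → b ≡ true → ⊥) → 𝟙 a + 𝟙 b ≤ 𝟙 c
𝟙-+-≤ {false} {false} a⇒c b⇒c a∧b⇒⊥ = z≤n
𝟙-+-≤ {false} {true}  a⇒c b⇒c a∧b⇒⊥ = 𝟙-mono b⇒c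
𝟙-+-≤ {true}  {false} a⇒c b⇒c a∧b⇒⊥ = 𝟙-mono a⇒c
𝟙-+-≤ {true}  {true}  a⇒c b⇒c a∧b⇒⊥ with () ← a∧b⇒⊥ refl refl

module _ {A : Set} where

  countIn : (A → Bool) → List A → ℕ
  countIn p xs = length (filterᵇ p xs)

  countIn-∷ : ∀ p x xs → countIn p (x ∷ xs) ≡ 𝟙 (p x) + countIn p xs
  countIn-∷ p x xs with p x
  ... | true  = refl
  ... | false = refl

  countIn-mono : (p q : A → Bool) → (∀ x → p x ≡ true → q x ≡ true) →
                 ∀ xs → countIn p xs ≤ countIn q xs
  countIn-mono p q p⇒q [] = z≤n
  countIn-mono p q p⇒q (x ∷ xs) rewrite countIn-∷ p x xs | countIn-∷ q x xs =
    +-mono-≤ (𝟙-mono (p⇒q x)) (countIn-mono p q p⇒q xs)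

  countIn-< : (p q : A → Bool) → (∀ x → p x ≡ true → q x ≡ true) →
              ∀ {w} → p w ≡ false → q w ≡ true → ∀ {xs} → w ∈ xs → countIn p xs < countIn q xs
  countIn-< p q p⇒q {w} pw qw {x ∷ xs} w∈x∷xs
    rewrite countIn-∷ p x xs | countIn-∷ q x xs with w∈x∷xs
  ... | Any.here refl rewrite pw | qw = s≤s (countIn-mono p q p⇒q xs)
  ... | Any.there w∈xs = +-mono-≤-< (𝟙-mono (p⇒q x)) (countIn-< p q p⇒q pw qw w∈xs)

  countIn-≤-+ : (p q r : A → Bool) → (∀ x → p x ≡ true → q x ≡ true ⊎ r x ≡ true) →
                ∀ xs → countIn p xs ≤ countIn q xs + countIn r xs
  countIn-≤-+ p q r p⇒q∨r [] = z≤n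
  countIn-≤-+ p q r p⇒q∨r (x ∷ xs)
    rewrite countIn-∷ p x xs | countIn-∷ q x xs | countIn-∷ r x xs =
    ≤-trans (+-mono-≤ (𝟙-≤-+ (p⇒q∨r x)) (countIn-≤-+ p q r p⇒q∨r xs))
            (≤-reflexive (interchange (𝟙 (q x)) (𝟙 (r x)) (countIn q xs) (countIn r xs)))

  countIn-+-≤ : (p q r : A → Bool) →
                (∀ x → p x ≡ true → r x ≡ true) → (∀ x → q x ≡ true → r x ≡ true) →
                (∀ x → p x ≡ true → q x ≡ true → ⊥) →
                ∀ xs → countIn p xs + countIn q xs ≤ countIn r xs
  countIn-+-≤ p q r p⇒r q⇒r p∧q⇒⊥ [] = z≤n
  countIn-+-≤ p q r p⇒r q⇒r p∧q⇒⊥ (x ∷ xs)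
    rewrite countIn-∷ p x xs | countIn-∷ q x xs | countIn-∷ r x xs =
    ≤-trans (≤-reflexive (interchange (𝟙 (p x)) (countIn p xs) (𝟙 (q x)) (countIn q xs)))
            (+-mono-≤ (𝟙-+-≤ (p⇒r x) (q⇒r x) (p∧q⇒⊥ x)) (countIn-+-≤ p q r p⇒r q⇒r p∧q⇒⊥ xs))

  countIn-≤-byWitness : (p : A → Bool) (b : ℕ) → ∀ xs →
                        (∀ x → p x ≡ true → countIn p xs ≤ b) → countIn p xs ≤ b
  countIn-≤-byWitness p b [] bound = z≤n
  countIn-≤-byWitness p b (x ∷ xs) bound with p x in px
  ... | true  = bound x px
  ... | false = countIn-≤-byWitness p b xs bound

tabulate-≤-sum : ∀ {m} (g : Fin m → ℕ) i → g i ≤ sum (tabulate g)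
tabulate-≤-sum g Fin.zero    = m≤m+n _ _
tabulate-≤-sum g (Fin.suc i) = ≤-trans (tabulate-≤-sum (g ∘ Fin.suc) i) (m≤n+m _ (g Fin.zero))

tabulate-pair-≤-sum : ∀ {m} (g : Fin m → ℕ) i j → i ≢ j → g i + g j ≤ sum (tabulate g)
tabulate-pair-≤-sum g Fin.zero    Fin.zero    i≢j with () ← i≢j refl
tabulate-pair-≤-sum g Fin.zero    (Fin.suc j) i≢j = +-monoʳ-≤ (g Fin.zero) (tabulate-≤-sum (g ∘ Fin.suc) j)
tabulate-pair-≤-sum g (Fin.suc i) Fin.zero    i≢j =
  ≤-trans (≤-reflexive (+-comm (g (Fin.suc i)) (g Fin.zero))) (tabulate-pair-≤-sum g Fin.zero (Fin.suc i) (i≢j ∘ sym))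
tabulate-pair-≤-sum g (Fin.suc i) (Fin.suc j) i≢j =
  ≤-trans (tabulate-pair-≤-sum (g ∘ Fin.suc) i j (i≢j ∘ cong Fin.suc)) (m≤n+m _ (g Fin.zero))

n≤1+2⌊n/2⌋ : ∀ n → n ≤ suc (2 * ⌊ n /2⌋)
n≤1+2⌊n/2⌋ zero          = z≤n
n≤1+2⌊n/2⌋ (suc zero)    = s≤s z≤n
n≤1+2⌊n/2⌋ (suc (suc n)) rewrite *-suc 2 ⌊ n /2⌋ = s≤s (s≤s (n≤1+2⌊n/2⌋ n))

2*[1+k]∸1≡1+2*k : ∀ k → 2 * suc k ∸ 1 ≡ suc (2 * k)
2*[1+k]∸1≡1+2*k k = +-suc k (k + 0)

2*[1+k]∸2≡2*k : ∀ k → 2 * suc k ∸ 2 ≡ 2 * k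
2*[1+k]∸2≡2*k k = cong (_∸ 1) (2*[1+k]∸1≡1+2*k k)

m+2n≤2[n+m] : ∀ m n → m + 2 * n ≤ 2 * (n + m)
m+2n≤2[n+m] m n = ≤-trans (m≤m+n (m + 2 * n) m) (≤-reflexive (eq m n))
  where eq : ∀ m n → m + 2 * n + m ≡ 2 * (n + m)
        eq = solve-∀

n+m≤o≤m⇒m+2n≤o : ∀ {m} n {o} → n + m ≤ o → o ≤ m → m + 2 * n ≤ o
n+m≤o≤m⇒m+2n≤o {m} zero    m≤o     o≤m = subst (_≤ _) (sym (+-identityʳ m)) m≤o
n+m≤o≤m⇒m+2n≤o {m} (suc n) 1+n+m≤o o≤m
  with () ← m+1+n≰m m (≤-trans (≤-reflexive (+-comm m (suc n))) (≤-trans 1+n+m≤o o≤m))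

two-large-halves-absurd : ∀ {k m n} a b → n + m ≤ k → a + b ≤ n →
                          suc k ≤ m + 2 * a → suc k ≤ m + 2 * b → ⊥
two-large-halves-absurd {k} {m} {n} a b n+m≤k a+b≤n k<m+2a k<m+2b = <-irrefl refl (begin-strict
    2 * k                       <⟨ n<1+n (2 * k) ⟩
    suc (2 * k)                 ≤⟨ n≤1+n (suc (2 * k)) ⟩
    suc (suc (2 * k))           ≡⟨ eq₁ k ⟩
    suc k + suc k               ≤⟨ +-mono-≤ k<m+2a k<m+2b ⟩
    m + 2 * a + (m + 2 * b)     ≡⟨ eq₂ m a b ⟩
    2 * (m + (a + b))           ≤⟨ *-monoʳ-≤ 2 (+-monoʳ-≤ m a+b≤n) ⟩
    2 * (m + n)                 ≡⟨ cong (2 *_) (+-comm m n) ⟩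
    2 * (n + m)                 ≤⟨ *-monoʳ-≤ 2 n+m≤k ⟩
    2 * k                       ∎)
  where
    open ≤-Reasoning
    eq₁ : ∀ k → suc (suc (2 * k)) ≡ suc k + suc k
    eq₁ = solve-∀
    eq₂ : ∀ m a b → m + 2 * a + (m + 2 * b) ≡ 2 * (m + (a + b))
    eq₂ = solve-∀

module EdgeClasses {n : ℕ} (k : ℕ) (G : Graph n) (u : Fin n) where

  heavy⁻ : ∀ v → heavy (suc k) G u v ≡ true → adj G u v ≡ true × suc (2 * k) ≤ codeg G u v
  heavy⁻ v uv-heavy with ∧-≡true⁻ uv-heavy
  ... | uv , lower = uv , subst (_≤ codeg G u v) (2*[1+k]∸1≡1+2*k k) (≤ᵇ-≡true⁻ lower)

  medium⁻ : ∀ v → medium (suc k) G u v ≡ true →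
            adj G u v ≡ true × suc k ≤ codeg G u v × codeg G u v ≤ 2 * k
  medium⁻ v uv-medium with ∧-≡true⁻ uv-medium
  ... | uv , bounds with ∧-≡true⁻ bounds
  ... | lower , upper = uv , ≤ᵇ-≡true⁻ lower , subst (codeg G u v ≤_) (2*[1+k]∸2≡2*k k) (≤ᵇ-≡true⁻ upper)

  heavy-medium-disjoint : ∀ v → heavy (suc k) G u v ≡ true → medium (suc k) G u v ≡ true → ⊥
  heavy-medium-disjoint v uv-heavy uv-medium =
    <-irrefl refl (≤-trans (proj₂ (heavy⁻ v uv-heavy)) (proj₂ (proj₂ (medium⁻ v uv-medium))))

module Components {n m : ℕ} (G : Graph n) (u : Fin n) (X : Fin n → Bool) (c : Fin n → Fin m)
                  (labelling : IsComponentLabelling G (GuMinus G u X) c) where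

  S : Fin n → Bool
  S = GuMinus G u X

  inComponent : Fin m → Fin n → Bool
  inComponent j v = S v ∧ does (c v Fin.≟ j)

  size : Fin m → ℕ
  size j = count (inComponent j)

  halfSum : ℕ
  halfSum = sumHalfComponents S c

  halfSum≡ : halfSum ≡ sum (tabulate (λ j → ⌊ size j /2⌋))
  halfSum≡ = cong sum (map-tabulate (λ j → j) (λ j → ⌊ size j /2⌋))

  half≤halfSum : ∀ j → ⌊ size j /2⌋ ≤ halfSum
  half≤halfSum j = subst (⌊ size j /2⌋ ≤_) (sym halfSum≡) (tabulate-≤-sum (λ j → ⌊ size j /2⌋) j)

  half-pair≤halfSum : ∀ i j → i ≢ j → ⌊ size i /2⌋ + ⌊ size j /2⌋ ≤ halfSum
  half-pair≤halfSum i j i≢j =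
    subst (⌊ size i /2⌋ + ⌊ size j /2⌋ ≤_) (sym halfSum≡) (tabulate-pair-≤-sum (λ j → ⌊ size j /2⌋) i j i≢j)

  inComponent⁺ : ∀ {v j} → S v ≡ true → c v ≡ j → inComponent j v ≡ true
  inComponent⁺ {v} Sv refl rewrite Sv = dec-true (c v Fin.≟ c v) refl

  S⁺ : ∀ {v} → adj G u v ≡ true → X v ≡ false → S v ≡ true
  S⁺ uv Xv rewrite uv | Xv = refl

  codeg<countX+size : ∀ {w} → adj G u w ≡ true → X w ≡ false → codeg G u w < count X + size (c w)
  codeg<countX+size {w} uw Xw = begin-strict
      codeg G u w                        ≤⟨ countIn-≤-+ common X outside split (allFin n) ⟩
      count X + count outside            <⟨ +-monoʳ-< (count X) outside<component ⟩
      count X + size (c w)               ∎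
    where
      open ≤-Reasoning
      common outside : Fin n → Bool
      common z = adj G u z ∧ adj G w z
      outside z = common z ∧ not (X z)

      split : ∀ z → common z ≡ true → X z ≡ true ⊎ outside z ≡ true
      split z common-z with X z
      ... | true  = inj₁ refl
      ... | false rewrite common-z = inj₂ refl

      outside⇒component : ∀ z → outside z ≡ true → inComponent (c w) z ≡ true
      outside⇒component z outside-z with ∧-≡true⁻ outside-z
      ... | common-z , notXz with ∧-≡true⁻ common-z
      ... | uz , wz = inComponent⁺ Sz (sym (proj₂ (labelling w z Sw Sz) (step (here Sw) wz Sz)))
        where Sw = S⁺ uw Xw
              Sz = S⁺ uz (not-≡true⁻ notXz)

      outside-w : outside w ≡ false
      outside-w rewrite uw | irrefl G w = refl

      outside<component : count outside < size (c w)
      outside<component = countIn-< outside (inComponent (c w)) outside⇒component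
        outside-w (inComponent⁺ (S⁺ uw Xw) refl) (∈-allFin w)

  codeg≤countX+2*half : ∀ {w} → adj G u w ≡ true → X w ≡ false →
                        codeg G u w ≤ count X + 2 * ⌊ size (c w) /2⌋
  codeg≤countX+2*half {w} uw Xw = s≤s⁻¹ (begin
      suc (codeg G u w)                   ≤⟨ codeg<countX+size uw Xw ⟩
      count X + size (c w)                ≤⟨ +-monoʳ-≤ (count X) (n≤1+2⌊n/2⌋ (size (c w))) ⟩
      count X + suc (2 * ⌊ size (c w) /2⌋) ≡⟨ +-suc (count X) _ ⟩
      suc (count X + 2 * ⌊ size (c w) /2⌋) ∎)
    where open ≤-Reasoning

module Bounds {n m : ℕ} (k : ℕ) (G : Graph n) (u : Fin n) (X : Fin n → Bool) (c : Fin n → Fin m)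
              (labelling : IsComponentLabelling G (GuMinus G u X) c)
              (budget : sumHalfComponents (GuMinus G u X) c + count X ≤ k) where

  -- Here k is the paper's k − 1, so that no truncated subtraction appears.

  open Components G u X c labelling
  open EdgeClasses k G u

  H M : Fin n → Bool
  H = 𝓗 (suc k) G u
  M = 𝓜 (suc k) G u

  countX≤k : count X ≤ k
  countX≤k = m+n≤o⇒n≤o halfSum budget

  codeg≤countX+2*halfSum : ∀ {w} → adj G u w ≡ true → X w ≡ false → codeg G u w ≤ count X + 2 * halfSum
  codeg≤countX+2*halfSum {w} uw Xw =
    ≤-trans (codeg≤countX+2*half uw Xw) (+-monoʳ-≤ (count X) (*-monoʳ-≤ 2 (half≤halfSum (c w))))

  codeg≤2k : ∀ {w} → adj G u w ≡ true → X w ≡ false → codeg G u w ≤ 2 * k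
  codeg≤2k {w} uw Xw = begin
      codeg G u w                ≤⟨ codeg≤countX+2*halfSum uw Xw ⟩
      count X + 2 * halfSum      ≤⟨ m+2n≤2[n+m] (count X) halfSum ⟩
      2 * (halfSum + count X)    ≤⟨ *-monoʳ-≤ 2 budget ⟩
      2 * k                      ∎
    where open ≤-Reasoning

  H⊆X : ∀ v → H v ≡ true → X v ≡ true
  H⊆X v Hv with X v in Xv | heavy⁻ v Hv
  ... | true  | _                = refl
  ... | false | uv , heavy-codeg with () ← <-irrefl refl (≤-trans heavy-codeg (codeg≤2k uv Xv))

  countH≤countX : count H ≤ count X
  countH≤countX = countIn-mono H X H⊆X (allFin n)

  countH≤k : count H ≤ k
  countH≤k = ≤-trans countH≤countX countX≤k

  H-full⇒codeg≤k : count H ≡ k → ∀ {w} → adj G u w ≡ true → X w ≡ false → codeg G u w ≤ k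
  H-full⇒codeg≤k countH≡k uw Xw = ≤-trans (codeg≤countX+2*halfSum uw Xw)
    (n+m≤o≤m⇒m+2n≤o halfSum budget (subst (_≤ count X) countH≡k countH≤countX))

  H-full⇒M-empty : count H ≡ k → ∀ v → M v ≡ false
  H-full⇒M-empty countH≡k v with M v in Mv
  ... | false = refl
  ... | true with X v in Xv | H v in Hv | medium⁻ v Mv
  ... | _     | true  | _ with () ← heavy-medium-disjoint v Hv Mv
  ... | true  | false | _ with () ← <-irrefl countH≡k
        (≤-trans (countIn-< H X H⊆X Hv Xv (∈-allFin v)) countX≤k)
  ... | false | false | uv , medium-codeg , _ with () ← <-irrefl refl
        (≤-trans medium-codeg (H-full⇒codeg≤k countH≡k uv Xv))

  M∩X M∖X : Fin n → Bool
  M∩X v = M v ∧ X v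
  M∖X v = M v ∧ not (X v)

  M∖X⁻ : ∀ {w} → M∖X w ≡ true →
         adj G u w ≡ true × X w ≡ false × suc k ≤ count X + 2 * ⌊ size (c w) /2⌋
  M∖X⁻ {w} M∖Xw with ∧-≡true⁻ M∖Xw
  ... | Mw , notXw with medium⁻ w Mw
  ... | uw , medium-codeg , _ =
    uw , not-≡true⁻ notXw , ≤-trans medium-codeg (codeg≤countX+2*half uw (not-≡true⁻ notXw))

  M∖X-sameComponent : ∀ {v w} → M∖X v ≡ true → M∖X w ≡ true → c w ≡ c v
  M∖X-sameComponent {v} {w} M∖Xv M∖Xw with c w Fin.≟ c v
  ... | yes cw≡cv = cw≡cv
  ... | no cw≢cv with () ← two-large-halves-absurd ⌊ size (c w) /2⌋ ⌊ size (c v) /2⌋ budget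
                             (half-pair≤halfSum (c w) (c v) cw≢cv)
                             (proj₂ (proj₂ (M∖X⁻ M∖Xw))) (proj₂ (proj₂ (M∖X⁻ M∖Xv)))

  M∖X⊆component : ∀ {v} → M∖X v ≡ true → ∀ w → M∖X w ≡ true → inComponent (c v) w ≡ true
  M∖X⊆component M∖Xv w M∖Xw with uw , Xw , _ ← M∖X⁻ M∖Xw =
    inComponent⁺ (S⁺ uw Xw) (M∖X-sameComponent M∖Xv M∖Xw)

  countM∖X≤1+2*halfSum : count M∖X ≤ suc (2 * halfSum)
  countM∖X≤1+2*halfSum = countIn-≤-byWitness M∖X _ (allFin n) λ v M∖Xv → begin
      count M∖X                    ≤⟨ countIn-mono M∖X (inComponent (c v)) (M∖X⊆component M∖Xv) (allFin n) ⟩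
      size (c v)                  ≤⟨ n≤1+2⌊n/2⌋ (size (c v)) ⟩
      suc (2 * ⌊ size (c v) /2⌋)  ≤⟨ s≤s (*-monoʳ-≤ 2 (half≤halfSum (c v))) ⟩
      suc (2 * halfSum)           ∎
    where open ≤-Reasoning

  countH+countM∩X≤countX : count H + count M∩X ≤ count X
  countH+countM∩X≤countX = countIn-+-≤ H M∩X X H⊆X (λ w M∩Xw → proj₂ (∧-≡true⁻ M∩Xw))
    (λ w Hw M∩Xw → heavy-medium-disjoint w Hw (proj₁ (∧-≡true⁻ M∩Xw))) (allFin n)

  countM≤countM∩X+countM∖X : count M ≤ count M∩X + count M∖X
  countM≤countM∩X+countM∖X = countIn-≤-+ M M∩X M∖X split (allFin n)
    where
      split : ∀ w → M w ≡ true → M∩X w ≡ true ⊎ M∖X w ≡ true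
      split w Mw rewrite Mw with X w
      ... | true  = inj₁ refl
      ... | false = inj₂ refl

  2*countH+countM≤1+2k : 2 * count H + count M ≤ suc (2 * k)
  2*countH+countM≤1+2k = begin
      2 * count H + count M                       ≤⟨ +-monoʳ-≤ (2 * count H) countM≤countM∩X+countM∖X ⟩
      2 * count H + (count M∩X + count M∖X)         ≡⟨ eq₁ (count H) (count M∩X) (count M∖X) ⟩
      count H + (count H + count M∩X) + count M∖X   ≤⟨ +-monoˡ-≤ (count M∖X) (+-mono-≤ countH≤countX countH+countM∩X≤countX) ⟩
      count X + count X + count M∖X                ≤⟨ +-monoʳ-≤ (count X + count X) countM∖X≤1+2*halfSum ⟩
      count X + count X + suc (2 * halfSum)       ≡⟨ eq₂ (count X) halfSum ⟩
      suc (2 * (halfSum + count X))               ≤⟨ s≤s (*-monoʳ-≤ 2 budget) ⟩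
      suc (2 * k)                                 ∎
    where
      open ≤-Reasoning
      eq₁ : ∀ h a b → 2 * h + (a + b) ≡ h + (h + a) + b
      eq₁ = solve-∀
      eq₂ : ∀ x s → x + x + suc (2 * s) ≡ suc (2 * (s + x))
      eq₂ = solve-∀

lemma1 : (k : ℕ) → 1 ≤ k → (n : ℕ) → (G : Graph n) → FkFree k G →
    (u : Fin n) → (X : Fin n → Bool) → (∀ v → X v ≡ true → adj G u v ≡ true) →
    (m : ℕ) → (c : Fin n → Fin m) → IsComponentLabelling G (GuMinus G u X) c →
    sumHalfComponents (GuMinus G u X) c + count X ≤ k ∸ 1 →
    ((∀ v → 𝓗 k G u v ≡ true → X v ≡ true)
    × (count (𝓗 k G u) ≤ k ∸ 1)
    × (count (𝓗 k G u) ≡ k ∸ 1 → ∀ v → 𝓜 k G u v ≡ false))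
    × (2 * count (𝓗 k G u) + count (𝓜 k G u) ≤ 2 * k ∸ 1)
lemma1 (suc k) _ n G _ u X _ m c labelling budget =
  (H⊆X , countH≤k , H-full⇒M-empty) ,
  subst (2 * count H + count M ≤_) (sym (2*[1+k]∸1≡1+2*k k)) 2*countH+countM≤1+2k
  where open Bounds k G u X c labelling budget
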